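{- Let $G$ be an interval graph with a unique perfect matching $M$, and let $([\ell_u,r_u])_{u\in V(G)}$ be an interval representation of $G$ (so $uv\in E(G)$ iff $u\neq v$ and $[\ell_u,r_u]\cap[\ell_v,r_v]\neq\emptyset$) such that all $2n(G)$ endpoints of the intervals $[\ell_u,r_u]$, $u\in V(G)$, are distinct. If $u^*\in V(G)$ is such that $r_{u^*}=\min\{r_u:u\in V(G)\}$, and $v^*\in N_G(u^*)$ is such that $r_{v^*}=\min\{r_v:v\in N_G(u^*)\}$, then $u^*v^*\in M$.
   Context: $n(G)$ denotes the number of vertices of $G$ and $N_G(u)$ the (open) neighborhood of $u$ in $G$.
   Formalization: The endpoints $\ell_u$ and $r_u$ of the representing intervals are rational numbers. -}

module Defs where

open import Data.Nat using (ℕ)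
open import Data.Fin using (Fin)
open import Data.Rational using (ℚ; _≤_)
open import Data.Product using (Σ; _×_; ∃)
open import Relation.Binary.PropositionalEquality using (_≡_; _≢_)
open import Function.Bundles using (_⇔_)
open import Level using (0ℓ)

-- An interval representation of a graph on vertex set Fin n:
-- vertex u is represented by the closed interval [ ℓ u , r u ] ⊆ ℚ.

_∈[_,_] : ℚ → ℚ → ℚ → Set
x ∈[ a , b ] = (a ≤ x) × (x ≤ b)

Adj : {n : ℕ} → (ℓ r : Fin n → ℚ) → Fin n → Fin n → Set
Adj ℓ r u v = (u ≢ v) × ∃ λ x → (x ∈[ ℓ u , r u ]) × (x ∈[ ℓ v , r v ])

IsIntervalRep : {n : ℕ} → (ℓ r : Fin n → ℚ) → Set
IsIntervalRep {n} ℓ r = (u : Fin n) → ℓ u ≤ r u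

DistinctEndpoints : {n : ℕ} → (ℓ r : Fin n → ℚ) → Set
DistinctEndpoints {n} ℓ r =
  ((u v : Fin n) → ℓ u ≡ ℓ v → u ≡ v) ×
  ((u v : Fin n) → r u ≡ r v → u ≡ v) ×
  ((u v : Fin n) → ℓ u ≢ r v)

EdgeSet : ℕ → Set₁
EdgeSet n = Fin n → Fin n → Set

IsPerfectMatching : {n : ℕ} → EdgeSet n → EdgeSet n → Set
IsPerfectMatching {n} E M =
  ((u v : Fin n) → M u v → M v u) ×
  ((u v : Fin n) → M u v → E u v) ×
  ((u : Fin n) → Σ (Fin n) λ v → M u v × ((w : Fin n) → M u w → w ≡ v))

IsUniquePerfectMatching : {n : ℕ} → EdgeSet n → EdgeSet n → Set₁
IsUniquePerfectMatching {n} E M =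
  IsPerfectMatching E M ×
  ((M′ : EdgeSet n) → IsPerfectMatching E M′ →
     (u v : Fin n) → M′ u v ⇔ M u v)

{-# OPTIONS --safe #-}
-- If the mate w of u* in M were not v*, let z be the mate of v*. Every
-- neighbour of u* starts before r u* ≤ r z, and every neighbour of v* starts
-- before r v* ≤ r w, so the intervals of w and z overlap. Then u* v* z w is
-- an M-alternating 4-cycle, and exchanging M along it gives a second perfect
-- matching.
module Submission where

open import Defs
open import Data.Nat using (ℕ)
open import Data.Fin using (Fin; _≟_)
open import Data.Rational using (ℚ; _≤_)
open import Data.Rational.Properties using (≤-trans; ≤-refl; ≤-total)
open import Data.Product using (Σ; _×_; ∃; _,_; proj₁; proj₂)
open import Data.Sum using (_⊎_; inj₁; inj₂)
open import Data.Empty using (⊥-elim)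
open import Relation.Nullary using (yes; no; ¬_)
open import Relation.Binary.Definitions using (Symmetric; Irreflexive)
open import Relation.Binary.PropositionalEquality using (_≡_; _≢_; refl; sym; trans; subst)
open import Function.Bundles using (Equivalence)

meet⇒≤ : ∀ {x a b c d} → x ∈[ a , b ] → x ∈[ c , d ] → a ≤ d
meet⇒≤ (a≤x , _) (_ , x≤d) = ≤-trans a≤x x≤d

overlap⇒meet : ∀ {a b c d} → a ≤ b → c ≤ d → a ≤ d → c ≤ b →
               ∃ λ x → x ∈[ a , b ] × x ∈[ c , d ]
overlap⇒meet {a} {_} {c} a≤b c≤d a≤d c≤b with ≤-total a c
... | inj₁ a≤c = c , (a≤c , c≤b) , (≤-refl , c≤d)
... | inj₂ c≤a = a , (≤-refl , a≤b) , (c≤a , a≤d)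

module _ {n : ℕ} (ℓ r : Fin n → ℚ) where

  Adj-sym : Symmetric (Adj ℓ r)
  Adj-sym (u≢v , x , x∈u , x∈v) = (λ e → u≢v (sym e)) , x , x∈v , x∈u

  Adj-irrefl : Irreflexive _≡_ (Adj ℓ r)
  Adj-irrefl u≡v (u≢v , _) = u≢v u≡v

  Adj⇒ℓ≤r : ∀ {u v} → Adj ℓ r u v → ℓ v ≤ r u
  Adj⇒ℓ≤r (_ , _ , x∈u , x∈v) = meet⇒≤ x∈v x∈u

  neighbours-of-first-pair-adjacent :
    IsIntervalRep ℓ r → ∀ {u* v* w z} →
    ((u : Fin n) → r u* ≤ r u) →
    ((v : Fin n) → Adj ℓ r u* v → r v* ≤ r v) →
    Adj ℓ r u* w → Adj ℓ r v* z → w ≢ z → Adj ℓ r w z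
  neighbours-of-first-pair-adjacent rep {u*} {v*} {w} {z} r-min r-min-nbr u*w v*z w≢z =
    w≢z , overlap⇒meet (rep w) (rep z) ℓw≤rz ℓz≤rw
    where
      ℓw≤rz : ℓ w ≤ r z
      ℓw≤rz = ≤-trans (Adj⇒ℓ≤r u*w) (r-min z)
      ℓz≤rw : ℓ z ≤ r w
      ℓz≤rw = ≤-trans (Adj⇒ℓ≤r v*z) (r-min-nbr w u*w)

module PerfectMatching {n : ℕ} {E M : EdgeSet n} (pm : IsPerfectMatching E M) where

  private variable a b c : Fin n

  M-sym : M a b → M b a
  M-sym = proj₁ pm _ _

  M⊆E : M a b → E a b
  M⊆E = proj₁ (proj₂ pm) _ _

  mate : Fin n → Fin n
  mate a = proj₁ (proj₂ (proj₂ pm) a)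

  M-mate : ∀ a → M a (mate a)
  M-mate a = proj₁ (proj₂ (proj₂ (proj₂ pm) a))

  mate-unique : M a b → b ≡ mate a
  mate-unique = proj₂ (proj₂ (proj₂ (proj₂ pm) _)) _

  M-functional : M a b → M a c → b ≡ c
  M-functional ab ac = trans (mate-unique ab) (sym (mate-unique ac))

  M-injective : M a c → M b c → a ≡ b
  M-injective ac bc = M-functional (M-sym ac) (M-sym bc)

module AlternatingSquare
  {n : ℕ} {E M : EdgeSet n} (E-sym : Symmetric E) (E-irrefl : Irreflexive _≡_ E)
  (pm : IsPerfectMatching E M)
  {u v w z : Fin n} (Euv : E u v) (Ewz : E w z) (Muw : M u w) (Mvz : M v z) (v≢w : v ≢ w)
  where

  open PerfectMatching pm

  private variable a b c : Fin n

  data Square : Fin n → Fin n → Set where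
    uv : Square u v
    vu : Square v u
    wz : Square w z
    zw : Square z w

  Outside : Fin n → Set
  Outside a = (a ≢ u) × (a ≢ v) × (a ≢ w) × (a ≢ z)

  u≢v : u ≢ v
  u≢v u≡v = E-irrefl u≡v Euv

  u≢w : u ≢ w
  u≢w u≡w = E-irrefl u≡w (M⊆E Muw)

  u≢z : u ≢ z
  u≢z refl = v≢w (M-functional (M-sym Mvz) Muw)

  v≢z : v ≢ z
  v≢z v≡z = E-irrefl v≡z (M⊆E Mvz)

  w≢z : w ≢ z
  w≢z refl = u≢v (M-injective Muw Mvz)

  Square-functional : Square a b → Square a c → b ≡ c
  Square-functional uv uv = refl
  Square-functional uv vu = ⊥-elim (u≢v refl)
  Square-functional uv wz = ⊥-elim (u≢w refl)
  Square-functional uv zw = ⊥-elim (u≢z refl)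
  Square-functional vu uv = ⊥-elim (u≢v refl)
  Square-functional vu vu = refl
  Square-functional vu wz = ⊥-elim (v≢w refl)
  Square-functional vu zw = ⊥-elim (v≢z refl)
  Square-functional wz uv = ⊥-elim (u≢w refl)
  Square-functional wz vu = ⊥-elim (v≢w refl)
  Square-functional wz wz = refl
  Square-functional wz zw = ⊥-elim (w≢z refl)
  Square-functional zw uv = ⊥-elim (u≢z refl)
  Square-functional zw vu = ⊥-elim (v≢z refl)
  Square-functional zw wz = ⊥-elim (w≢z refl)
  Square-functional zw zw = refl

  Square-sym : Square a b → Square b a
  Square-sym uv = vu
  Square-sym vu = uv
  Square-sym wz = zw
  Square-sym zw = wz

  Square⊆E : Square a b → E a b
  Square⊆E uv = Euv
  Square⊆E vu = E-sym Euv
  Square⊆E wz = Ewz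
  Square⊆E zw = E-sym Ewz

  Square⇒¬Outside : Square a b → ¬ Outside a
  Square⇒¬Outside uv (a≢u , _) = a≢u refl
  Square⇒¬Outside vu (_ , a≢v , _) = a≢v refl
  Square⇒¬Outside wz (_ , _ , a≢w , _) = a≢w refl
  Square⇒¬Outside zw (_ , _ , _ , a≢z) = a≢z refl

  corner? : (a : Fin n) → ∃ (Square a) ⊎ Outside a
  corner? a with a ≟ u | a ≟ v | a ≟ w | a ≟ z
  ... | yes refl | _        | _        | _        = inj₁ (v , uv)
  ... | no _     | yes refl | _        | _        = inj₁ (u , vu)
  ... | no _     | no _     | yes refl | _        = inj₁ (z , wz)
  ... | no _     | no _     | no _     | yes refl = inj₁ (w , zw)
  ... | no a≢u   | no a≢v   | no a≢w   | no a≢z   = inj₂ (a≢u , a≢v , a≢w , a≢z)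

  Outside-closed : Outside a → M a b → Outside b
  Outside-closed (a≢u , a≢v , a≢w , a≢z) ab =
    (λ { refl → a≢w (M-functional (M-sym ab) Muw) }) ,
    (λ { refl → a≢z (M-functional (M-sym ab) Mvz) }) ,
    (λ { refl → a≢u (M-injective ab Muw) }) ,
    (λ { refl → a≢v (M-injective ab Mvz) })

  Exchanged : EdgeSet n
  Exchanged a b = Square a b ⊎ (Outside a × M a b)

  Exchanged-sym : (a b : Fin n) → Exchanged a b → Exchanged b a
  Exchanged-sym _ _ (inj₁ ab)         = inj₁ (Square-sym ab)
  Exchanged-sym _ _ (inj₂ (a∉ , ab)) = inj₂ (Outside-closed a∉ ab , M-sym ab)

  Exchanged⊆E : (a b : Fin n) → Exchanged a b → E a b
  Exchanged⊆E _ _ (inj₁ ab)      = Square⊆E ab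
  Exchanged⊆E _ _ (inj₂ (_ , ab)) = M⊆E ab

  Exchanged-partner : (a : Fin n) →
    Σ (Fin n) λ b → Exchanged a b × ((c : Fin n) → Exchanged a c → c ≡ b)
  Exchanged-partner a with corner? a
  ... | inj₁ (b , ab) = b , inj₁ ab , unique
    where
      unique : (c : Fin n) → Exchanged a c → c ≡ b
      unique c (inj₁ ac)       = Square-functional ac ab
      unique c (inj₂ (a∉ , _)) = ⊥-elim (Square⇒¬Outside ab a∉)
  ... | inj₂ a∉ = mate a , inj₂ (a∉ , M-mate a) , unique
    where
      unique : (c : Fin n) → Exchanged a c → c ≡ mate a
      unique c (inj₁ ac)      = ⊥-elim (Square⇒¬Outside ac a∉)
      unique c (inj₂ (_ , ac)) = mate-unique ac

  Exchanged-isPerfectMatching : IsPerfectMatching E Exchanged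
  Exchanged-isPerfectMatching = Exchanged-sym , Exchanged⊆E , Exchanged-partner

alternatingSquare⇒matched :
  ∀ {n} {E M : EdgeSet n} → Symmetric E → Irreflexive _≡_ E →
  IsUniquePerfectMatching E M → ∀ {u v w z} →
  E u v → E w z → M u w → M v z → M u v
alternatingSquare⇒matched E-sym E-irrefl (pm , unique) {u} {v} {w} Euv Ewz Muw Mvz
  with v ≟ w
... | yes refl = Muw
... | no v≢w   = Equivalence.to (unique Exchanged Exchanged-isPerfectMatching u v) (inj₁ uv)
  where open AlternatingSquare E-sym E-irrefl pm Euv Ewz Muw Mvz v≢w

lemma2 : (n : ℕ) (ℓ r : Fin n → ℚ) →
    IsIntervalRep ℓ r →
    DistinctEndpoints ℓ r →
    (M : EdgeSet n) →
    IsUniquePerfectMatching (Adj ℓ r) M →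
    (u* v* : Fin n) →
    ((u : Fin n) → r u* ≤ r u) →
    Adj ℓ r u* v* →
    ((v : Fin n) → Adj ℓ r u* v → r v* ≤ r v) →
    M u* v*
lemma2 n ℓ r rep _ M (pm , unique) u* v* r-min u*v* r-min-nbr =
  alternatingSquare⇒matched (Adj-sym ℓ r) (Adj-irrefl ℓ r) (pm , unique)
    u*v* wz (M-mate u*) (M-mate v*)
  where
    open PerfectMatching pm
    w≢z : mate u* ≢ mate v*
    w≢z w≡z = proj₁ u*v* (M-injective (M-mate u*) (subst (M v*) (sym w≡z) (M-mate v*)))
    wz : Adj ℓ r (mate u*) (mate v*)
    wz = neighbours-of-first-pair-adjacent ℓ r rep r-min r-min-nbr
           (M⊆E (M-mate u*)) (M⊆E (M-mate v*)) w≢z
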